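{- Let $p$ be a prime, $n\in\mathbb{Z}$ and $\nu\in\mathbb{Z}_{\ge 0}$. Then \[1-\frac1p\le p^{ -\nu}N^{U(1)}_{0,n}(p^\nu)\le \nu+1.\]
   Context: $U(1)=U$ is $\mathbb{Z}^2$ with quadratic form $Q(x,y)=xy$. For an even lattice $L$, $\gamma\in L'$, $n\in\mathbb{Z}-Q(\gamma)$ and a positive integer $a$, the representation number is $N^L_{\gamma,n}(a)=\#\{r\in L/aL: Q(r-\gamma)+n\equiv 0 \pmod a\}$. In particular $N^{U(1)}_{0,n}(p^\nu)=\#\{(x,y)\in(\mathbb{Z}/p^\nu\mathbb{Z})^2: xy+n\equiv 0\pmod{p^\nu}\}$. -}

module Defs where

open import Data.Nat as ℕ using (ℕ)
open import Data.Nat.Divisibility using (_∣?_)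
open import Data.Integer as ℤ using (ℤ; +_; ∣_∣)
open import Data.Integer.Divisibility using (_∣_)
open import Data.Fin using (Fin; toℕ)
open import Data.List using (List; length; filter; cartesianProduct; allFin)
open import Data.Product using (_×_; _,_)
open import Relation.Nullary using (Dec)

-- Decidability of integer divisibility (ℤ._∣_ is ℕ._∣_ on absolute values).
_∣ℤ?_ : (a b : ℤ) → Dec (a ∣ b)
a ∣ℤ? b = ∣ a ∣ ∣? ∣ b ∣

-- N^{U(1)}_{0,n}(a) = #{ (x,y) ∈ (ℤ/aℤ)² : x*y + n ≡ 0 (mod a) },
-- with ℤ/aℤ represented by the residues 0,…,a-1 (Fin a).
N-U1 : ℤ → ℕ → ℕ
N-U1 n a = length (filter (λ xy → let (x , y) = xy in
                              (+ a) ∣ℤ? ((+ toℕ x) ℤ.* (+ toℕ y) ℤ.+ n))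
                          (cartesianProduct (allFin a) (allFin a)))

-- Count pairs (x, y) modulo p^(m+1) with x y + r ≡ 0 by the residue of x modulo p.
-- A unit x gives exactly one y, so these contribute p^m (p - 1).  A multiple x = i p
-- gives nothing unless p ∣ r, and for r = r' p it gives p times the number of
-- solutions of i y + r' ≡ 0 modulo p^m.  Hence N(p^(m+1), r) is p^m (p - 1), plus
-- p N(p^m, r / p) when p ∣ r, and both bounds follow by induction on m.
module Submission where

open import Defs
open import Data.Nat using (ℕ; zero; suc; _+_; _*_; _∸_; _^_; _≤_; _<_; z<s; s<s; s<s⁻¹; NonZero)
open import Data.Nat.Properties
open import Data.Nat.Divisibility
  using (_∣_; _∣?_; divides; ∣m+n∣m⇒∣n; ∣m∣n⇒∣m+n; n∣m*n; m∣m*n; ∣n⇒∣m*n; ∣m⇒∣m*n; ∣⇒≤; ∣-trans; ∣1⇒≡1;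
         *-cancelʳ-∣; *-monoˡ-∣)
open import Data.Nat.DivMod using (_%_; _/_; m%n<n; m≡m%n+[m/n]*n)
open import Data.Nat.Coprimality using (Coprime; coprime-Bézout; coprime-divisor; 1-coprimeTo)
open import Data.Nat.GCD using (module Bézout)
open import Data.Nat.Primality using (Prime; prime⇒nonZero; prime⇒irreducible)
open import Data.Nat.ListAction using (sum)
open import Data.Nat.ListAction.Properties using (sum-++)
open import Data.Nat.Tactic.RingSolver using (solve-∀)
open import Data.Integer as ℤ using (ℤ)
open import Data.Integer.Properties using (pos-+; pos-*) renaming (+-assoc to ℤ-+-assoc)
open import Data.Integer.DivMod using (_%ℕ_; _/ℕ_; a≡a%ℕn+[a/ℕn]*n)
open import Data.Integer.Divisibility.Signed as Signed using (∣ᵤ⇒∣; ∣⇒∣ᵤ)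
open import Data.Fin using (toℕ)
open import Data.List using ([]; _∷_; _++_; map; length; filter; cartesianProduct; allFin; tabulate)
open import Data.List.Properties using (map-++; map-∘; map-tabulate)
open import Data.Product using (_×_; _,_; proj₁; proj₂; ∃-syntax)
open import Data.Sum using (inj₁; inj₂)
open import Function using (_∘_; _⇔_; mk⇔; Equivalence)
open import Relation.Nullary using (Dec; yes; no; ¬_; contradiction)
open import Relation.Unary using (Decidable)
open import Relation.Binary.PropositionalEquality
  using (_≡_; refl; sym; trans; cong; cong₂; subst; subst₂; module ≡-Reasoning)

∑ : ℕ → (ℕ → ℕ) → ℕ
∑ zero    f = 0
∑ (suc k) f = f 0 + ∑ k (f ∘ suc)

∑-cong : ∀ k {f g : ℕ → ℕ} → (∀ i → i < k → f i ≡ g i) → ∑ k f ≡ ∑ k g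
∑-cong zero    eq = refl
∑-cong (suc k) eq = cong₂ _+_ (eq 0 z<s) (∑-cong k (λ i i<k → eq (suc i) (s<s i<k)))

∑-const : ∀ k c → ∑ k (λ _ → c) ≡ k * c
∑-const zero    c = refl
∑-const (suc k) c = cong (c +_) (∑-const k c)

∑-≡0 : ∀ k {f : ℕ → ℕ} → (∀ i → i < k → f i ≡ 0) → ∑ k f ≡ 0
∑-≡0 k eq = trans (∑-cong k eq) (trans (∑-const k 0) (*-zeroʳ k))

∑-pred : ∀ k .{{_ : NonZero k}} (f : ℕ → ℕ) → ∑ k f ≡ f 0 + ∑ (k ∸ 1) (f ∘ suc)
∑-pred (suc k) f = refl

∑-+ : ∀ k (f g : ℕ → ℕ) → ∑ k (λ i → f i + g i) ≡ ∑ k f + ∑ k g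
∑-+ zero    f g = refl
∑-+ (suc k) f g = begin
  (f 0 + g 0) + ∑ k (λ i → f (suc i) + g (suc i))   ≡⟨ cong (f 0 + g 0 +_) (∑-+ k (f ∘ suc) (g ∘ suc)) ⟩
  (f 0 + g 0) + (∑ k (f ∘ suc) + ∑ k (g ∘ suc))     ≡⟨ +-+-interchange (f 0) (g 0) _ _ ⟩
  (f 0 + ∑ k (f ∘ suc)) + (g 0 + ∑ k (g ∘ suc))     ∎
  where
  open ≡-Reasoning
  +-+-interchange : ∀ a b c d → (a + b) + (c + d) ≡ (a + c) + (b + d)
  +-+-interchange = solve-∀

*-distribˡ-∑ : ∀ k c (f : ℕ → ℕ) → c * ∑ k f ≡ ∑ k (λ i → c * f i)
*-distribˡ-∑ zero    c f = *-zeroʳ c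
*-distribˡ-∑ (suc k) c f = trans (*-distribˡ-+ c (f 0) _) (cong (c * f 0 +_) (*-distribˡ-∑ k c (f ∘ suc)))

∑-++ : ∀ a b (f : ℕ → ℕ) → ∑ (a + b) f ≡ ∑ a f + ∑ b (λ i → f (a + i))
∑-++ zero    b f = refl
∑-++ (suc a) b f = trans (cong (f 0 +_) (∑-++ a b (f ∘ suc))) (sym (+-assoc (f 0) _ _))

∑-blocks : ∀ a b (f : ℕ → ℕ) → ∑ (a * b) f ≡ ∑ a (λ i → ∑ b (λ j → f (i * b + j)))
∑-blocks zero    b f = refl
∑-blocks (suc a) b f = begin
  ∑ (b + a * b) f                                          ≡⟨ ∑-++ b (a * b) f ⟩
  ∑ b f + ∑ (a * b) (λ k → f (b + k))                      ≡⟨ cong (∑ b f +_) (∑-blocks a b (λ k → f (b + k))) ⟩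
  ∑ b f + ∑ a (λ i → ∑ b (λ j → f (b + (i * b + j))))      ≡⟨ cong (∑ b f +_) (∑-cong a (λ i _ → ∑-cong b (λ j _ →
                                                                cong f (sym (+-assoc b (i * b) j))))) ⟩
  ∑ b f + ∑ a (λ i → ∑ b (λ j → f (b + i * b + j)))        ∎
  where open ≡-Reasoning

∑-periodic : ∀ k M (f : ℕ → ℕ) → (∀ t j → f (t * M + j) ≡ f j) → ∑ (k * M) f ≡ k * ∑ M f
∑-periodic k M f periodic = begin
  ∑ (k * M) f                                    ≡⟨ ∑-blocks k M f ⟩
  ∑ k (λ t → ∑ M (λ j → f (t * M + j)))          ≡⟨ ∑-cong k (λ t _ → ∑-cong M (λ j _ → periodic t j)) ⟩
  ∑ k (λ _ → ∑ M f)                              ≡⟨ ∑-const k (∑ M f) ⟩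
  k * ∑ M f                                      ∎
  where open ≡-Reasoning

𝟙 : {P : Set} → Dec P → ℕ
𝟙 (yes _) = 1
𝟙 (no  _) = 0

𝟙-cong : {P Q : Set} → P ⇔ Q → (P? : Dec P) (Q? : Dec Q) → 𝟙 P? ≡ 𝟙 Q?
𝟙-cong P⇔Q (yes _) (yes _) = refl
𝟙-cong P⇔Q (yes p) (no ¬q) = contradiction (Equivalence.to P⇔Q p) ¬q
𝟙-cong P⇔Q (no ¬p) (yes q) = contradiction (Equivalence.from P⇔Q q) ¬p
𝟙-cong P⇔Q (no _)  (no _)  = refl

count : {P : ℕ → Set} → ℕ → Decidable P → ℕ
count k P? = ∑ k (λ i → 𝟙 (P? i))

count-cong : ∀ k {P Q : ℕ → Set} (P? : Decidable P) (Q? : Decidable Q) →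
  (∀ i → P i ⇔ Q i) → count k P? ≡ count k Q?
count-cong k P? Q? P⇔Q = ∑-cong k (λ i _ → 𝟙-cong (P⇔Q i) (P? i) (Q? i))

count-≡0 : ∀ k {P : ℕ → Set} (P? : Decidable P) → (∀ i → i < k → ¬ P i) → count k P? ≡ 0
count-≡0 k P? none = ∑-≡0 k λ i i<k → 𝟙-no (P? i) (none i i<k)
  where
  𝟙-no : {A : Set} (A? : Dec A) → ¬ A → 𝟙 A? ≡ 0
  𝟙-no (yes a) ¬a = contradiction a ¬a
  𝟙-no (no _)  _  = refl

count-≡1 : ∀ k {P : ℕ → Set} (P? : Decidable P) {y} → y < k → P y →
  (∀ {i j} → i < k → j < k → P i → P j → i ≡ j) → count k P? ≡ 1
count-≡1 (suc k) P? {y} y<k Py unique with P? 0 | y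
... | yes P0 | _      = cong suc (count-≡0 k (P? ∘ suc) λ i i<k Psi →
                          0≢1+n (unique z<s (s<s i<k) P0 Psi))
... | no ¬P0 | zero   = contradiction Py ¬P0
... | no _   | suc y' = count-≡1 k (P? ∘ suc) (s<s⁻¹ y<k) Py λ i<k j<k Pi Pj →
                          suc-injective (unique (s<s i<k) (s<s j<k) Pi Pj)

∣m⇒[∣m+n⇔∣n] : ∀ {d m n} → d ∣ m → (d ∣ m + n ⇔ d ∣ n)
∣m⇒[∣m+n⇔∣n] d∣m = mk⇔ (λ d∣m+n → ∣m+n∣m⇒∣n d∣m+n d∣m) (∣m∣n⇒∣m+n d∣m)

∣∧<⇒≡0 : ∀ {d n} → d ∣ n → n < d → n ≡ 0
∣∧<⇒≡0 {n = zero}  _   _   = refl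
∣∧<⇒≡0 {n = suc n} d∣n n<d = contradiction (∣⇒≤ d∣n) (<⇒≱ n<d)

coprime-* : ∀ {m n o} → Coprime m o → Coprime n o → Coprime (m * n) o
coprime-* {m} m⊥o n⊥o (i∣mn , i∣o) = n⊥o (coprime-divisor i⊥m i∣mn , i∣o)
  where
  i⊥m : Coprime _ m
  i⊥m (j∣i , j∣m) = m⊥o (j∣m , ∣-trans j∣i i∣o)

coprime-^ : ∀ {m n} → Coprime m n → ∀ k → Coprime (m ^ k) n
coprime-^ m⊥n zero    (i∣1 , _) = ∣1⇒≡1 i∣1
coprime-^ m⊥n (suc k)           = coprime-* m⊥n (coprime-^ m⊥n k)

prime∧∤⇒coprime : ∀ {p n} → Prime p → ¬ p ∣ n → Coprime p n
prime∧∤⇒coprime p-prime p∤n {i} (i∣p , i∣n) with prime⇒irreducible p-prime i∣p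
... | inj₁ i≡1  = i≡1
... | inj₂ refl = contradiction i∣n p∤n

-- Linear congruences x y + r ≡ 0 (mod M)

#roots : ℕ → ℕ → ℕ → ℕ
#roots M x r = count M (λ y → M ∣? x * y + r)

coprime⇒∃[t]∣x*t+1 : ∀ {M x} .{{_ : NonZero M}} → Coprime M x → ∃[ t ] M ∣ x * t + 1
coprime⇒∃[t]∣x*t+1 {M@(suc s)} {x} M⊥x with coprime-Bézout M⊥x
... | Bézout.+- u v eq = v , divides u (trans (+-comm (x * v) 1) (trans (cong (1 +_) (*-comm x v)) eq))
... | Bézout.-+ u v eq = v * s , divides (1 + u * s) (begin
  x * (v * s) + 1          ≡⟨ regroup x v s ⟩
  (v * x) * s + 1          ≡⟨ cong (λ z → z * s + 1) (sym eq) ⟩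
  (1 + u * M) * s + 1      ≡⟨ expand u s ⟩
  (1 + u * s) * M          ∎)
  where
  open ≡-Reasoning
  regroup : ∀ x v s → x * (v * s) + 1 ≡ (v * x) * s + 1
  regroup = solve-∀
  expand : ∀ u s → (1 + u * suc s) * s + 1 ≡ (1 + u * s) * suc s
  expand = solve-∀

∣x*t+r⇒∣x*[t%M]+r : ∀ {M x t r} .{{_ : NonZero M}} → M ∣ x * t + r → M ∣ x * (t % M) + r
∣x*t+r⇒∣x*[t%M]+r {M} {x} {t} {r} M∣ =
  Equivalence.to (∣m⇒[∣m+n⇔∣n] (∣n⇒∣m*n x (n∣m*n (t / M)))) (subst (M ∣_) split M∣)
  where
  split : x * t + r ≡ x * (t / M * M) + (x * (t % M) + r)
  split = begin
    x * t + r                             ≡⟨ cong (λ z → x * z + r) (m≡m%n+[m/n]*n t M) ⟩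
    x * (t % M + t / M * M) + r           ≡⟨ regroup x r (t % M) (t / M * M) ⟩
    x * (t / M * M) + (x * (t % M) + r)   ∎
    where
    open ≡-Reasoning
    regroup : ∀ x r a b → x * (a + b) + r ≡ x * b + (x * a + r)
    regroup = solve-∀

coprime⇒root-unique : ∀ {M x r y y'} → Coprime M x → y ≤ y' → y' < M →
  M ∣ x * y + r → M ∣ x * y' + r → y ≡ y'
coprime⇒root-unique {M} {x} {r} {y} {y'} M⊥x y≤y' y'<M M∣y M∣y' =
  ≤-antisym y≤y' (m∸n≡0⇒m≤n (∣∧<⇒≡0 M∣y'∸y (≤-<-trans (m∸n≤m y' y) y'<M)))
  where
  shift : x * y' + r ≡ (x * y + r) + x * (y' ∸ y)
  shift = begin
    x * y' + r                   ≡⟨ cong (λ z → x * z + r) (sym (m+[n∸m]≡n y≤y')) ⟩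
    x * (y + (y' ∸ y)) + r       ≡⟨ regroup x y (y' ∸ y) r ⟩
    (x * y + r) + x * (y' ∸ y)   ∎
    where
    open ≡-Reasoning
    regroup : ∀ x y d r → x * (y + d) + r ≡ (x * y + r) + x * d
    regroup = solve-∀
  M∣y'∸y : M ∣ y' ∸ y
  M∣y'∸y = coprime-divisor M⊥x (Equivalence.to (∣m⇒[∣m+n⇔∣n] M∣y) (subst (M ∣_) shift M∣y'))

#roots-coprime : ∀ {M x} r .{{_ : NonZero M}} → Coprime M x → #roots M x r ≡ 1
#roots-coprime {M} {x} r M⊥x = count-≡1 M (λ y → M ∣? x * y + r) (m%n<n (t * r) M) root unique
  where
  t : ℕ
  t = proj₁ (coprime⇒∃[t]∣x*t+1 M⊥x)
  root : M ∣ x * ((t * r) % M) + r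
  root = ∣x*t+r⇒∣x*[t%M]+r {x = x} {t = t * r}
           (subst (M ∣_) (regroup x t r) (∣m⇒∣m*n r (proj₂ (coprime⇒∃[t]∣x*t+1 M⊥x))))
    where
    regroup : ∀ x t r → (x * t + 1) * r ≡ x * (t * r) + r
    regroup = solve-∀
  unique : ∀ {i j} → i < M → j < M → M ∣ x * i + r → M ∣ x * j + r → i ≡ j
  unique {i} {j} i<M j<M M∣i M∣j with ≤-total i j
  ... | inj₁ i≤j = coprime⇒root-unique M⊥x i≤j j<M M∣i M∣j
  ... | inj₂ j≤i = sym (coprime⇒root-unique M⊥x j≤i i<M M∣j M∣i)

#roots-scale : ∀ k M x r .{{_ : NonZero k}} → #roots (k * M) (x * k) (r * k) ≡ k * #roots M x r
#roots-scale k M x r = begin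
  count (k * M) (λ y → k * M ∣? x * k * y + r * k)   ≡⟨ count-cong (k * M) _ _ (λ y → cancel y) ⟩
  count (k * M) (λ y → M ∣? x * y + r)               ≡⟨ ∑-periodic k M _ (λ t j → 𝟙-cong (periodic t j) _ _) ⟩
  k * #roots M x r                                    ∎
  where
  open ≡-Reasoning
  factor : ∀ y → x * k * y + r * k ≡ (x * y + r) * k
  factor y = regroup x k y r
    where
    regroup : ∀ x k y r → x * k * y + r * k ≡ (x * y + r) * k
    regroup = solve-∀
  cancel : ∀ y → (k * M ∣ x * k * y + r * k) ⇔ (M ∣ x * y + r)
  cancel y = mk⇔
    (λ kM∣ → *-cancelʳ-∣ k (subst₂ _∣_ (*-comm k M) (factor y) kM∣))
    (λ M∣ → subst₂ _∣_ (*-comm M k) (sym (factor y)) (*-monoˡ-∣ k M∣))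
  periodic : ∀ t j → (M ∣ x * (t * M + j) + r) ⇔ (M ∣ x * j + r)
  periodic t j = subst (λ z → (M ∣ z) ⇔ (M ∣ x * j + r)) (sym (regroup x t M j r))
                   (∣m⇒[∣m+n⇔∣n] (n∣m*n (x * t)))
    where
    regroup : ∀ x t M j r → x * (t * M + j) + r ≡ x * t * M + (x * j + r)
    regroup = solve-∀

#roots-≡0 : ∀ {p M x r} → p ∣ M → p ∣ x → ¬ p ∣ r → #roots M x r ≡ 0
#roots-≡0 {M = M} p∣M p∣x p∤r = count-≡0 M _ λ y _ M∣ →
  p∤r (Equivalence.to (∣m⇒[∣m+n⇔∣n] (∣-trans p∣x (m∣m*n y))) (∣-trans p∣M M∣))

-- Points of x y + r ≡ 0 (mod M), and the recursion for prime powers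

#points : ℕ → ℕ → ℕ
#points M r = ∑ M (λ x → #roots M x r)

#points-1 : ∀ r → #points 1 r ≡ 1
#points-1 r = cong (_+ 0) (#roots-coprime r (1-coprimeTo 0))

module _ {p} (p-prime : Prime p) where

  private instance
    p≢0 : NonZero p
    p≢0 = prime⇒nonZero p-prime

  ∤[i*p+1+j] : ∀ i {j} → j < p ∸ 1 → ¬ p ∣ i * p + suc j
  ∤[i*p+1+j] i j<p∸1 p∣ =
    <⇒≱ (<∸1⇒suc< j<p∸1) (∣⇒≤ (∣m+n∣m⇒∣n p∣ (n∣m*n i)))
    where
    <∸1⇒suc< : ∀ {m n} → m < n ∸ 1 → suc m < n
    <∸1⇒suc< {n = suc n} m<n = s<s m<n

  #points-suc : ∀ m r →
    #points (p ^ suc m) r ≡ ∑ (p ^ m) (λ i → #roots (p ^ suc m) (i * p) r) + p ^ m * (p ∸ 1)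
  #points-suc m r = begin
    ∑ (p * p ^ m) F                                                  ≡⟨ cong (λ k → ∑ k F) (*-comm p (p ^ m)) ⟩
    ∑ (p ^ m * p) F                                                  ≡⟨ ∑-blocks (p ^ m) p F ⟩
    ∑ (p ^ m) (λ i → ∑ p (λ j → F (i * p + j)))                      ≡⟨ ∑-cong (p ^ m) (λ i _ → ∑-pred p _) ⟩
    ∑ (p ^ m) (λ i → F (i * p + 0) + ∑ (p ∸ 1) (λ j → F (i * p + suc j)))
                                                                     ≡⟨ ∑-+ (p ^ m) _ _ ⟩
    ∑ (p ^ m) (λ i → F (i * p + 0)) + ∑ (p ^ m) (λ i → ∑ (p ∸ 1) (λ j → F (i * p + suc j)))
                                                                     ≡⟨ cong₂ _+_ (∑-cong (p ^ m) (λ i _ → cong F (+-identityʳ (i * p))))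
                                                                                  (∑-cong (p ^ m) (λ i _ → units i)) ⟩
    ∑ (p ^ m) (λ i → F (i * p)) + ∑ (p ^ m) (λ _ → p ∸ 1)            ≡⟨ cong (∑ (p ^ m) (λ i → F (i * p)) +_) (∑-const (p ^ m) (p ∸ 1)) ⟩
    ∑ (p ^ m) (λ i → F (i * p)) + p ^ m * (p ∸ 1)                    ∎
    where
    open ≡-Reasoning
    instance
      pᵐ⁺¹≢0 : NonZero (p ^ suc m)
      pᵐ⁺¹≢0 = m^n≢0 p (suc m)
    F : ℕ → ℕ
    F x = #roots (p ^ suc m) x r
    units : ∀ i → ∑ (p ∸ 1) (λ j → F (i * p + suc j)) ≡ p ∸ 1
    units i = begin
      ∑ (p ∸ 1) (λ j → F (i * p + suc j))   ≡⟨ ∑-cong (p ∸ 1) (λ j j< → #roots-coprime r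
                                                  (coprime-^ (prime∧∤⇒coprime p-prime (∤[i*p+1+j] i j<)) (suc m))) ⟩
      ∑ (p ∸ 1) (λ _ → 1)                   ≡⟨ ∑-const (p ∸ 1) 1 ⟩
      (p ∸ 1) * 1                           ≡⟨ *-identityʳ (p ∸ 1) ⟩
      p ∸ 1                                 ∎

  #points-suc-∣ : ∀ m r → #points (p ^ suc m) (r * p) ≡ p * #points (p ^ m) r + p ^ m * (p ∸ 1)
  #points-suc-∣ m r = trans (#points-suc m (r * p)) (cong (_+ p ^ m * (p ∸ 1)) (begin
    ∑ (p ^ m) (λ i → #roots (p * p ^ m) (i * p) (r * p))   ≡⟨ ∑-cong (p ^ m) (λ i _ → #roots-scale p (p ^ m) i r) ⟩
    ∑ (p ^ m) (λ i → p * #roots (p ^ m) i r)               ≡⟨ *-distribˡ-∑ (p ^ m) p _ ⟨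
    p * #points (p ^ m) r                                  ∎))
    where open ≡-Reasoning

  #points-suc-∤ : ∀ m r → ¬ p ∣ r → #points (p ^ suc m) r ≡ p ^ m * (p ∸ 1)
  #points-suc-∤ m r p∤r = trans (#points-suc m r) (cong (_+ p ^ m * (p ∸ 1))
    (∑-≡0 (p ^ m) (λ i _ → #roots-≡0 (m∣m*n (p ^ m)) (n∣m*n i) p∤r)))

  #points-lower : ∀ m r → (p ∸ 1) * p ^ m ≤ p * #points (p ^ m) r
  #points-lower zero r = begin
    (p ∸ 1) * 1          ≤⟨ *-monoˡ-≤ 1 (m∸n≤m p 1) ⟩
    p * 1                ≡⟨ cong (p *_) (#points-1 r) ⟨
    p * #points 1 r      ∎
    where open ≤-Reasoning
  #points-lower (suc m) r = begin
    (p ∸ 1) * (p * p ^ m)                                      ≡⟨ regroup (p ∸ 1) p (p ^ m) ⟩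
    p * (p ^ m * (p ∸ 1))                                      ≤⟨ *-monoʳ-≤ p (m≤n+m _ _) ⟩
    p * (∑ (p ^ m) (λ i → #roots (p ^ suc m) (i * p) r) + p ^ m * (p ∸ 1))
                                                               ≡⟨ cong (p *_) (#points-suc m r) ⟨
    p * #points (p ^ suc m) r                                  ∎
    where
    open ≤-Reasoning
    regroup : ∀ a p P → a * (p * P) ≡ p * (P * a)
    regroup = solve-∀

  #points-upper : ∀ m r → #points (p ^ m) r ≤ suc m * p ^ m
  #points-upper zero    r = ≤-reflexive (#points-1 r)
  #points-upper (suc m) r with p ∣? r
  ... | yes (divides q refl) = begin
    #points (p ^ suc m) (q * p)                     ≡⟨ #points-suc-∣ m q ⟩
    p * #points (p ^ m) q + p ^ m * (p ∸ 1)         ≤⟨ +-mono-≤ (*-monoʳ-≤ p (#points-upper m q))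
                                                                (*-monoʳ-≤ (p ^ m) (m∸n≤m p 1)) ⟩
    p * (suc m * p ^ m) + p ^ m * p                 ≡⟨ regroup p m (p ^ m) ⟩
    suc (suc m) * (p * p ^ m)                       ∎
    where
    open ≤-Reasoning
    regroup : ∀ p m P → p * (suc m * P) + P * p ≡ suc (suc m) * (p * P)
    regroup = solve-∀
  ... | no p∤r = begin
    #points (p ^ suc m) r                           ≡⟨ #points-suc-∤ m r p∤r ⟩
    p ^ m * (p ∸ 1)                                 ≤⟨ *-monoʳ-≤ (p ^ m) (m∸n≤m p 1) ⟩
    p ^ m * p                                       ≡⟨ *-comm (p ^ m) p ⟩
    p * p ^ m                                       ≤⟨ m≤m+n (p * p ^ m) _ ⟩
    suc (suc m) * (p * p ^ m)                       ∎
    where open ≤-Reasoning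

length-filter≡sum : ∀ {A : Set} {P : A → Set} (P? : Decidable P) xs →
  length (filter P? xs) ≡ sum (map (𝟙 ∘ P?) xs)
length-filter≡sum P? []       = refl
length-filter≡sum P? (x ∷ xs) with P? x
... | yes _ = cong suc (length-filter≡sum P? xs)
... | no  _ = length-filter≡sum P? xs

sum-map-cartesianProduct : ∀ {A B : Set} (f : A × B → ℕ) xs ys →
  sum (map f (cartesianProduct xs ys)) ≡ sum (map (λ x → sum (map (λ y → f (x , y)) ys)) xs)
sum-map-cartesianProduct f []       ys = refl
sum-map-cartesianProduct f (x ∷ xs) ys = begin
  sum (map f (map (x ,_) ys ++ cartesianProduct xs ys))
    ≡⟨ cong sum (map-++ f (map (x ,_) ys) _) ⟩
  sum (map f (map (x ,_) ys) ++ map f (cartesianProduct xs ys))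
    ≡⟨ sum-++ (map f (map (x ,_) ys)) _ ⟩
  sum (map f (map (x ,_) ys)) + sum (map f (cartesianProduct xs ys))
    ≡⟨ cong₂ _+_ (cong sum (sym (map-∘ ys))) (sum-map-cartesianProduct f xs ys) ⟩
  sum (map (λ y → f (x , y)) ys) + sum (map (λ x → sum (map (λ y → f (x , y)) ys)) xs)
    ∎
  where open ≡-Reasoning

sum-map-allFin : ∀ k (f : ℕ → ℕ) → sum (map (f ∘ toℕ) (allFin k)) ≡ ∑ k f
sum-map-allFin k f = trans (cong sum (map-tabulate {n = k} (λ i → i) (f ∘ toℕ))) (sum-tabulate k f)
  where
  sum-tabulate : ∀ k (f : ℕ → ℕ) → sum (tabulate {n = k} (f ∘ toℕ)) ≡ ∑ k f
  sum-tabulate zero    f = refl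
  sum-tabulate (suc k) f = cong (f 0 +_) (sum-tabulate k (f ∘ suc))

length-filter-allFin² : ∀ k {Q : ℕ → ℕ → Set} (Q? : ∀ x → Decidable (Q x)) →
  length (filter (λ xy → Q? (toℕ (proj₁ xy)) (toℕ (proj₂ xy))) (cartesianProduct (allFin k) (allFin k)))
    ≡ ∑ k (λ x → count k (Q? x))
length-filter-allFin² k {Q} Q? = begin
  length (filter P? (cartesianProduct (allFin k) (allFin k)))
    ≡⟨ length-filter≡sum P? (cartesianProduct (allFin k) (allFin k)) ⟩
  sum (map (𝟙 ∘ P?) (cartesianProduct (allFin k) (allFin k)))
    ≡⟨ sum-map-cartesianProduct (𝟙 ∘ P?) (allFin k) (allFin k) ⟩
  sum (map (λ x → sum (map (λ y → 𝟙 (Q? (toℕ x) (toℕ y))) (allFin k))) (allFin k))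
    ≡⟨ sum-map-allFin k (λ x → sum (map (λ y → 𝟙 (Q? x (toℕ y))) (allFin k))) ⟩
  ∑ k (λ x → sum (map (λ y → 𝟙 (Q? x (toℕ y))) (allFin k)))
    ≡⟨ ∑-cong k (λ x _ → sum-map-allFin k (λ y → 𝟙 (Q? x y))) ⟩
  ∑ k (λ x → count k (Q? x))
    ∎
  where
  open ≡-Reasoning
  P? : Decidable (λ xy → Q (toℕ (proj₁ xy)) (toℕ (proj₂ xy)))
  P? xy = Q? (toℕ (proj₁ xy)) (toℕ (proj₂ xy))

∣ℤ⇔∣%ℕ : ∀ M .{{_ : NonZero M}} k n → M ∣ ℤ.∣ ℤ.+ k ℤ.+ n ∣ ⇔ M ∣ k + n %ℕ M
∣ℤ⇔∣%ℕ M k n = subst (λ z → M ∣ ℤ.∣ z ∣ ⇔ M ∣ k + n %ℕ M) (sym split) (mk⇔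
  (λ M∣ → ∣⇒∣ᵤ {i = a} (Signed.∣m+n∣n⇒∣m (∣ᵤ⇒∣ {i = a ℤ.+ b} M∣) M∣qM))
  (λ M∣ → ∣⇒∣ᵤ {i = a ℤ.+ b} (Signed.∣m∣n⇒∣m+n (∣ᵤ⇒∣ {i = a} M∣) M∣qM)))
  where
  a b : ℤ
  a = ℤ.+ (k + n %ℕ M)
  b = (n /ℕ M) ℤ.* ℤ.+ M
  M∣qM : ℤ.+ M Signed.∣ b
  M∣qM = Signed.∣n⇒∣m*n (n /ℕ M) Signed.∣-refl
  split : ℤ.+ k ℤ.+ n ≡ a ℤ.+ b
  split = begin
    ℤ.+ k ℤ.+ n                                                 ≡⟨ cong (λ z → ℤ.+ k ℤ.+ z) (a≡a%ℕn+[a/ℕn]*n n M) ⟩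
    ℤ.+ k ℤ.+ (ℤ.+ (n %ℕ M) ℤ.+ (n /ℕ M) ℤ.* ℤ.+ M)             ≡⟨ ℤ-+-assoc (ℤ.+ k) (ℤ.+ (n %ℕ M)) ((n /ℕ M) ℤ.* ℤ.+ M) ⟨
    (ℤ.+ k ℤ.+ ℤ.+ (n %ℕ M)) ℤ.+ (n /ℕ M) ℤ.* ℤ.+ M             ≡⟨ cong (λ z → z ℤ.+ (n /ℕ M) ℤ.* ℤ.+ M) (pos-+ k (n %ℕ M)) ⟨
    ℤ.+ (k + n %ℕ M) ℤ.+ (n /ℕ M) ℤ.* ℤ.+ M                     ∎
    where open ≡-Reasoning

N-U1≡#points : ∀ n M .{{_ : NonZero M}} → N-U1 n M ≡ #points M (n %ℕ M)
N-U1≡#points n M = trans (length-filter-allFin² M (λ x y → (ℤ.+ M) ∣ℤ? (ℤ.+ x ℤ.* ℤ.+ y ℤ.+ n)))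
  (∑-cong M (λ x _ → count-cong M _ _ λ y →
    subst (λ z → M ∣ ℤ.∣ z ℤ.+ n ∣ ⇔ M ∣ x * y + n %ℕ M) (pos-* x y) (∣ℤ⇔∣%ℕ M (x * y) n)))

corollary3p4 : (p : ℕ) → Prime p → (n : ℤ) → (ν : ℕ) →
    ((p ∸ 1) * p ^ ν ≤ p * N-U1 n (p ^ ν)) × (N-U1 n (p ^ ν) ≤ suc ν * p ^ ν)
corollary3p4 p p-prime n ν =
  subst (λ N → ((p ∸ 1) * p ^ ν ≤ p * N) × (N ≤ suc ν * p ^ ν)) (sym (N-U1≡#points n (p ^ ν)))
    (#points-lower p-prime ν r , #points-upper p-prime ν r)
  where
  instance
    pᵛ≢0 : NonZero (p ^ ν)
    pᵛ≢0 = m^n≢0 p ν {{prime⇒nonZero p-prime}}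
  r : ℕ
  r = n %ℕ p ^ ν
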